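{- Let $Q,Q'$ be unital quantales and $f:Q\to Q'$ a homomorphism of unital quantales, with residuum $f_\ast:Q'\to Q$ (so $f_\ast(y)=\bigvee\{x\in Q\mid f(x)\le y\}$), and let $\gamma=f_\ast\circ f$. Then the image $Q_\gamma=\gamma[Q]$ coincides with the set of $(\ker f)$-saturated elements of $Q$, where $\ker f=\{(a,b)\in Q\times Q\mid f(a)=f(b)\}$.
   Context: A unital quantale is a complete lattice with an associative multiplication with unit $1$ distributing over arbitrary joins in both arguments; a homomorphism of unital quantales preserves arbitrary joins, multiplication and unit. For $R\subseteq Q\times Q$, an element $s\in Q$ is $R$-saturated if for all $(a,b)\in R$ and all $c,d\in Q$: $cad\le s$ iff $cbd\le s$; $ac\le s$ iff $bc\le s$; $ca\le s$ iff $cb\le s$; $a\le s$ iff $b\le s$. -}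

module Defs where

open import Level using (Level; suc; _⊔_)
open import Data.Product using (Σ; ∃; _×_; _,_)
open import Relation.Unary using (Pred; _∈_)
open import Relation.Binary.PropositionalEquality using (_≡_)
open import Relation.Binary.Structures using (IsPartialOrder)

record UnitalQuantale (ℓ : Level) : Set (suc ℓ) where
  infixl 7 _·_
  infix 4 _≤_
  field
    Carrier        : Set ℓ
    _≤_            : Carrier → Carrier → Set ℓ
    isPartialOrder : IsPartialOrder _≡_ _≤_
    ⋁              : Pred Carrier ℓ → Carrier
    ⋁-upper        : ∀ (S : Pred Carrier ℓ) x → x ∈ S → x ≤ ⋁ S
    ⋁-least        : ∀ (S : Pred Carrier ℓ) y → (∀ x → x ∈ S → x ≤ y) → ⋁ S ≤ y
    _·_            : Carrier → Carrier → Carrier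
    1q             : Carrier
    ·-assoc        : ∀ a b c → (a · b) · c ≡ a · (b · c)
    ·-identityˡ    : ∀ a → 1q · a ≡ a
    ·-identityʳ    : ∀ a → a · 1q ≡ a
    ·-distribˡ-⋁   : ∀ a (S : Pred Carrier ℓ) →
                     a · ⋁ S ≡ ⋁ (λ z → Σ Carrier λ x → x ∈ S × z ≡ a · x)
    ·-distribʳ-⋁   : ∀ (S : Pred Carrier ℓ) a →
                     ⋁ S · a ≡ ⋁ (λ z → Σ Carrier λ x → x ∈ S × z ≡ x · a)

open UnitalQuantale public using (Carrier)

module _ {ℓ : Level} (Q Q′ : UnitalQuantale ℓ) where
  private
    module Q  = UnitalQuantale Q
    module Q′ = UnitalQuantale Q′

  record IsQuantaleHom (f : Q.Carrier → Q′.Carrier) : Set (suc ℓ) where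
    field
      ⋁-hom : ∀ (S : Pred Q.Carrier ℓ) →
              f (Q.⋁ S) ≡ Q′.⋁ (λ y → Σ Q.Carrier λ x → x ∈ S × y ≡ f x)
      ·-hom : ∀ a b → f (a Q.· b) ≡ f a Q′.· f b
      1-hom : f Q.1q ≡ Q′.1q

  residuum : (Q.Carrier → Q′.Carrier) → Q′.Carrier → Q.Carrier
  residuum f y = Q.⋁ (λ x → f x Q′.≤ y)

  γ : (Q.Carrier → Q′.Carrier) → Q.Carrier → Q.Carrier
  γ f x = residuum f (f x)

  ker : (Q.Carrier → Q′.Carrier) → Q.Carrier → Q.Carrier → Set ℓ
  ker f a b = f a ≡ f b

module _ {ℓ r : Level} (Q : UnitalQuantale ℓ) where
  private module Q = UnitalQuantale Q

  _⇔_ : ∀ {a b} → Set a → Set b → Set (a ⊔ b)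
  A ⇔ B = (A → B) × (B → A)

  Saturated : (Q.Carrier → Q.Carrier → Set r) → Q.Carrier → Set (ℓ ⊔ r)
  Saturated R s = ∀ a b → R a b → ∀ c d →
      ((c Q.· a Q.· d Q.≤ s) ⇔ (c Q.· b Q.· d Q.≤ s))
    × ((a Q.· c Q.≤ s) ⇔ (b Q.· c Q.≤ s))
    × ((c Q.· a Q.≤ s) ⇔ (c Q.· b Q.≤ s))
    × ((a Q.≤ s) ⇔ (b Q.≤ s))

module Submission where

-- A join-preserving map f : Q → Q′ has the right adjoint
-- f_*(y) = ⋁ {x | f x ≤ y}, i.e. t ≤ f_* y ⇔ f t ≤ y.  Consequently
-- whether t lies below an element f_* y depends only on f t, so every
-- element of the form γ x = f_*(f x) is closed under replacing a by b
-- whenever f a = f b.  Since f also preserves products, ker f is a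
-- congruence for multiplication on both sides, and the four clauses of
-- (ker f)-saturation all follow.  Conversely, if s is saturated then
-- s ≤ γ s by adjointness, and for x with f x ≤ f s the binary join x ∨ s
-- satisfies f (x ∨ s) = f s; the last saturation clause turns s ≤ s into
-- x ∨ s ≤ s, so x ≤ s and γ s ≤ s.

open import Defs
open import Level using (Level)
open import Data.Product using (Σ; _×_; _,_; proj₂)
open import Data.Sum using (_⊎_; inj₁; inj₂)
open import Relation.Unary using (Pred; _∈_)
open import Relation.Binary.PropositionalEquality using (_≡_; refl; sym; cong; subst)
open import Relation.Binary.Structures using (IsPartialOrder)

module BinaryJoin {ℓ : Level} (Q : UnitalQuantale ℓ) where
  open UnitalQuantale Q renaming (Carrier to A)
  open IsPartialOrder isPartialOrder using (antisym) renaming (refl to ≤-refl)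

  pair : A → A → Pred A ℓ
  pair a b z = (z ≡ a) ⊎ (z ≡ b)

  infixr 6 _∨_
  _∨_ : A → A → A
  a ∨ b = ⋁ (pair a b)

  ∨-upperˡ : ∀ a b → a ≤ a ∨ b
  ∨-upperˡ a b = ⋁-upper (pair a b) a (inj₁ refl)

  ∨-upperʳ : ∀ a b → b ≤ a ∨ b
  ∨-upperʳ a b = ⋁-upper (pair a b) b (inj₂ refl)

  ∨-absorbʳ : ∀ {a b} → a ≤ b → a ∨ b ≡ b
  ∨-absorbʳ {a} {b} a≤b = antisym (⋁-least (pair a b) b bound) (∨-upperʳ a b)
    where
    bound : ∀ x → x ∈ pair a b → x ≤ b
    bound x (inj₁ refl) = a≤b
    bound x (inj₂ refl) = ≤-refl

module JoinPreserving {ℓ : Level} (Q Q′ : UnitalQuantale ℓ)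
    (f : Carrier Q → Carrier Q′)
    (⋁-hom : ∀ (S : Pred (Carrier Q) ℓ) →
             f (UnitalQuantale.⋁ Q S)
               ≡ UnitalQuantale.⋁ Q′ (λ y → Σ (Carrier Q) λ x → x ∈ S × y ≡ f x))
    where
  private
    module Q  = UnitalQuantale Q
    module Q′ = UnitalQuantale Q′
    module P  = IsPartialOrder Q.isPartialOrder
    module P′ = IsPartialOrder Q′.isPartialOrder
  open BinaryJoin Q

  f_* : Carrier Q′ → Carrier Q
  f_* = residuum Q Q′ f

  image-⋁-least : ∀ (S : Pred (Carrier Q) ℓ) y →
                  (∀ x → x ∈ S → f x Q′.≤ y) → f (Q.⋁ S) Q′.≤ y
  image-⋁-least S y bound = subst (Q′._≤ y) (sym (⋁-hom S))
    (Q′.⋁-least _ y λ { _ (x , x∈S , refl) → bound x x∈S })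

  image-∨-least : ∀ {a b y} → f a Q′.≤ y → f b Q′.≤ y → f (a ∨ b) Q′.≤ y
  image-∨-least {a} {b} {y} fa≤y fb≤y = image-⋁-least (pair a b) y bound
    where
    bound : ∀ x → x ∈ pair a b → f x Q′.≤ y
    bound x (inj₁ refl) = fa≤y
    bound x (inj₂ refl) = fb≤y

  -- Join preservation implies monotonicity, since a ≤ b means a ∨ b ≡ b.
  monotone : ∀ {a b} → a Q.≤ b → f a Q′.≤ f b
  monotone {a} {b} a≤b =
    subst (λ t → f a Q′.≤ f t) (∨-absorbʳ a≤b)
      (subst (f a Q′.≤_) (sym (⋁-hom (pair a b)))
        (Q′.⋁-upper _ (f a) (a , inj₁ refl , refl)))

  counit : ∀ y → f (f_* y) Q′.≤ y
  counit y = image-⋁-least (λ x → f x Q′.≤ y) y (λ _ fx≤y → fx≤y)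

  adjoint-to : ∀ {t y} → t Q.≤ f_* y → f t Q′.≤ y
  adjoint-to {y = y} t≤f_*y = P′.trans (monotone t≤f_*y) (counit y)

  adjoint-from : ∀ {t y} → f t Q′.≤ y → t Q.≤ f_* y
  adjoint-from {t} ft≤y = Q.⋁-upper _ t ft≤y

  residuum-respects-ker : ∀ y {u v} → f u ≡ f v → u Q.≤ f_* y → v Q.≤ f_* y
  residuum-respects-ker y fu≡fv u≤ = adjoint-from (subst (Q′._≤ y) fu≡fv (adjoint-to u≤))

  -- An element whose down-set is closed under ker f is fixed by γ = f_* ∘ f:
  -- s ≤ γ s is the unit, and any x with f x ≤ f s has f (x ∨ s) ≡ f s.
  γ-fixed : ∀ s → (∀ a b → f a ≡ f b → b Q.≤ s → a Q.≤ s) → γ Q Q′ f s ≡ s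
  γ-fixed s closed = P.antisym (Q.⋁-least _ s below) (adjoint-from P′.refl)
    where
    below : ∀ x → f x Q′.≤ f s → x Q.≤ s
    below x fx≤fs = P.trans (∨-upperˡ x s) x∨s≤s
      where
      f[x∨s]≡fs : f (x ∨ s) ≡ f s
      f[x∨s]≡fs = P′.antisym (image-∨-least fx≤fs P′.refl) (monotone (∨-upperʳ x s))

      x∨s≤s : x ∨ s Q.≤ s
      x∨s≤s = closed (x ∨ s) s f[x∨s]≡fs P.refl

module KernelCongruence {ℓ : Level} (Q Q′ : UnitalQuantale ℓ)
    (f : Carrier Q → Carrier Q′)
    (·-hom : ∀ a b → f (UnitalQuantale._·_ Q a b)
                     ≡ UnitalQuantale._·_ Q′ (f a) (f b))
    where
  private
    module Q  = UnitalQuantale Q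
    module Q′ = UnitalQuantale Q′

  ker-congˡ : ∀ c {a b} → f a ≡ f b → f (c Q.· a) ≡ f (c Q.· b)
  ker-congˡ c {a} {b} fa≡fb rewrite ·-hom c a | ·-hom c b = cong (f c Q′.·_) fa≡fb

  ker-congʳ : ∀ c {a b} → f a ≡ f b → f (a Q.· c) ≡ f (b Q.· c)
  ker-congʳ c {a} {b} fa≡fb rewrite ·-hom a c | ·-hom b c = cong (Q′._· f c) fa≡fb

module _ {ℓ : Level} (Q Q′ : UnitalQuantale ℓ)
    (f : Carrier Q → Carrier Q′) (hom : IsQuantaleHom Q Q′ f) where
  private
    module Q = UnitalQuantale Q
  open IsQuantaleHom hom
  open JoinPreserving Q Q′ f ⋁-hom
  open KernelCongruence Q Q′ f ·-hom

  γ-image-saturated : ∀ x → Saturated Q (ker Q Q′ f) (γ Q Q′ f x)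
  γ-image-saturated x a b fa≡fb c d =
      both (ker-congʳ d (ker-congˡ c fa≡fb))
    , both (ker-congʳ c fa≡fb)
    , both (ker-congˡ c fa≡fb)
    , both fa≡fb
    where
    both : ∀ {u v} → f u ≡ f v →
           (u Q.≤ γ Q Q′ f x → v Q.≤ γ Q Q′ f x)
         × (v Q.≤ γ Q Q′ f x → u Q.≤ γ Q Q′ f x)
    both fu≡fv = residuum-respects-ker (f x) fu≡fv
               , residuum-respects-ker (f x) (sym fu≡fv)

  saturated-γ-fixed : ∀ s → Saturated Q (ker Q Q′ f) s → γ Q Q′ f s ≡ s
  saturated-γ-fixed s sat = γ-fixed s λ a b fa≡fb →
    proj₂ (proj₂ (proj₂ (proj₂ (sat a b fa≡fb Q.1q Q.1q))))

lemma4p11 : {ℓ : Level} (Q Q′ : UnitalQuantale ℓ)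
    (f : Carrier Q → Carrier Q′) → IsQuantaleHom Q Q′ f →
    ∀ (s : Carrier Q) →
    ((Σ (Carrier Q) λ x → γ Q Q′ f x ≡ s) → Saturated Q (ker Q Q′ f) s)
    × (Saturated Q (ker Q Q′ f) s → Σ (Carrier Q) λ x → γ Q Q′ f x ≡ s)
lemma4p11 Q Q′ f hom s =
    (λ { (x , refl) → γ-image-saturated Q Q′ f hom x })
  , (λ sat → s , saturated-γ-fixed Q Q′ f hom s sat)
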